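{- Let $G$ and $H$ be two graphs that are not both complete. (i) If $\gamma(G)=1$, then $\mu_t(G+H)= {\rm n}(G)+{\rm n}(H)-1$. (ii) If $\gamma(G)\ne 1$ and $\gamma(H)\ne 1$, then $\mu_t(G + H)= {\rm n}(G)+{\rm n}(H)-2$.
   Context: All graphs are finite, simple and undirected (with nonempty vertex sets). ${\rm n}(G)$ is the order and $\gamma(G)$ the domination number of $G$. The join $G+H$ is obtained from disjoint copies of $G$ and $H$ by adding all edges between a vertex of $G$ and a vertex of $H$. For a graph $F$ and $X\subseteq V(F)$, two vertices $x,y$ are $X$-visible if there is a shortest $x,y$-path in $F$ none of whose internal vertices lies in $X$. $X$ is a total mutual-visibility set of $F$ if every two vertices of $F$ are $X$-visible; $\mu_t(F)$ is the maximum cardinality of such a set. -}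

module Defs where

open import Data.Nat using (ℕ; zero; suc; _+_; _≤_; _<_)
open import Data.Fin using (Fin; splitAt)
open import Data.Fin.Subset using (Subset; _∈_; _∉_; ∣_∣)
open import Data.Bool using (Bool; true; false)
open import Data.Sum using (_⊎_; inj₁; inj₂)
open import Data.Product using (Σ; ∃; _×_; _,_)
open import Relation.Binary.PropositionalEquality using (_≡_; _≢_; refl)
open import Relation.Nullary using (¬_)

record Graph (n : ℕ) : Set where
  field
    adj   : Fin n → Fin n → Bool
    sym   : ∀ x y → adj x y ≡ adj y x
    irref : ∀ x → adj x x ≡ false
open Graph public

Adj : ∀ {n} → Graph n → Fin n → Fin n → Set
Adj G x y = adj G x y ≡ true

-- Join G + H on Fin (a + b): first a vertices are G, last b are H.
joinAdj : ∀ {a b} → Graph a → Graph b → Fin (a + b) → Fin (a + b) → Bool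
joinAdj {a} G H u v with splitAt a u | splitAt a v
... | inj₁ x | inj₁ y = adj G x y
... | inj₂ x | inj₂ y = adj H x y
... | inj₁ _ | inj₂ _ = true
... | inj₂ _ | inj₁ _ = true

joinSym : ∀ {a b} (G : Graph a) (H : Graph b) u v → joinAdj G H u v ≡ joinAdj G H v u
joinSym {a} G H u v with splitAt a u | splitAt a v
... | inj₁ x | inj₁ y = sym G x y
... | inj₂ x | inj₂ y = sym H x y
... | inj₁ _ | inj₂ _ = refl
... | inj₂ _ | inj₁ _ = refl

joinIrr : ∀ {a b} (G : Graph a) (H : Graph b) u → joinAdj G H u u ≡ false
joinIrr {a} G H u with splitAt a u
... | inj₁ x = irref G x
... | inj₂ x = irref H x

_⊕_ : ∀ {a b} → Graph a → Graph b → Graph (a + b)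
G ⊕ H = record { adj = joinAdj G H ; sym = joinSym G H ; irref = joinIrr G H }

Complete : ∀ {n} → Graph n → Set
Complete G = ∀ x y → x ≢ y → Adj G x y

Dominating : ∀ {n} → Graph n → Subset n → Set
Dominating {n} G D = ∀ (v : Fin n) → v ∈ D ⊎ ∃ λ u → u ∈ D × Adj G u v

IsDominationNumber : ∀ {n} → Graph n → ℕ → Set
IsDominationNumber G k =
  (∃ λ D → Dominating G D × ∣ D ∣ ≡ k) × (∀ D → Dominating G D → k ≤ ∣ D ∣)

IsWalk : ∀ {n} → Graph n → Fin n → Fin n → (ℓ : ℕ) → (ℕ → Fin n) → Set
IsWalk G x y ℓ f = (f 0 ≡ x) × (f ℓ ≡ y) × (∀ i → i < ℓ → Adj G (f i) (f (suc i)))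

IsShortest : ∀ {n} → Graph n → Fin n → Fin n → (ℓ : ℕ) → (ℕ → Fin n) → Set
IsShortest G x y ℓ f = IsWalk G x y ℓ f × (∀ ℓ' g → IsWalk G x y ℓ' g → ℓ ≤ ℓ')

Visible : ∀ {n} → Graph n → Subset n → Fin n → Fin n → Set
Visible G X x y = ∃ λ ℓ → ∃ λ f → IsShortest G x y ℓ f ×
  (∀ i → 0 < i → i < ℓ → f i ∉ X)

IsTotalMutualVisibility : ∀ {n} → Graph n → Subset n → Set
IsTotalMutualVisibility {n} G X = ∀ (x y : Fin n) → Visible G X x y

IsMuT : ∀ {n} → Graph n → ℕ → Set
IsMuT G k = (∃ λ X → IsTotalMutualVisibility G X × ∣ X ∣ ≡ k)
          × (∀ X → IsTotalMutualVisibility G X → ∣ X ∣ ≤ k)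

{-# OPTIONS --safe #-}
-- In a graph of diameter at most two, X is a total mutual-visibility set exactly when every
-- non-adjacent pair has a common neighbour outside X.  A join has diameter at most two: two
-- non-adjacent vertices lie on the same side, and every vertex of the other side is a common
-- neighbour.  Hence the complement of a universal vertex, or of one vertex from each side, is
-- such a set.  Conversely, the inner vertex w of a shortest path between non-adjacent vertices
-- avoids X; if w is not universal, a shortest path from w to a non-neighbour leaves a second
-- vertex outside X.
module Submission where

open import Defs hiding (sym)
open import Data.Bool using (true)
import Data.Bool.Properties as Bool
open import Data.Empty using (⊥-elim)
open import Data.Fin using (Fin; zero; suc; splitAt; _↑ˡ_; _↑ʳ_; _≟_)
open import Data.Fin.Properties using (¬∀⟶∃¬; all?; ↑ˡ-injective; ↑ʳ-injective; splitAt-↑ˡ; splitAt-↑ʳ; splitAt⁻¹-↑ˡ; splitAt⁻¹-↑ʳ)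
open import Data.Fin.Subset using (Subset; _∈_; _∉_; _⊆_; ∣_∣; ⁅_⁆; ∁; _-_; inside; outside)
open import Data.Fin.Subset.Properties using (x∈⁅x⁆; x≢y⇒x∉⁅y⁆; x∈p⇒x∉∁p; x∉p⇒x∈∁p; x∈p∧x≢y⇒x∈p-y; p─q⊆p; p─⊥≡p; ∣∁p∣≡n∸∣p∣; ∣⁅x⁆∣≡1; p⊆q⇒∣p∣≤∣q∣)
open import Data.Nat using (ℕ; suc; _+_; _∸_; pred; _≤_; _<_; z≤n; s≤s)
open import Data.Nat.Properties using (suc-injective; pred[m∸n]≡m∸[1+n])
open import Data.Product using (_×_; ∃; _,_; proj₂)
open import Data.Sum using (inj₁; inj₂)
open import Data.Vec using (_∷_; here; there)
open import Function using (_∘_)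
open import Relation.Binary.PropositionalEquality using (_≡_; _≢_; refl; sym; trans; cong; subst; subst₂; module ≡-Reasoning)
open import Relation.Nullary using (¬_; Dec; yes; no; ¬?; _→-dec_; contradiction)

private variable n : ℕ

x∈p⇒∣p∣≡1+∣p-x∣ : ∀ {p : Subset n} {x} → x ∈ p → ∣ p ∣ ≡ suc ∣ p - x ∣
x∈p⇒∣p∣≡1+∣p-x∣ {p = inside  ∷ p} here        = cong suc (cong ∣_∣ (sym (p─⊥≡p p)))
x∈p⇒∣p∣≡1+∣p-x∣ {p = inside  ∷ p} (there x∈p) = cong suc (x∈p⇒∣p∣≡1+∣p-x∣ x∈p)
x∈p⇒∣p∣≡1+∣p-x∣ {p = outside ∷ p} (there x∈p) = x∈p⇒∣p∣≡1+∣p-x∣ x∈p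

x∈p⇒1≤∣p∣ : ∀ {p : Subset n} {x} → x ∈ p → 1 ≤ ∣ p ∣
x∈p⇒1≤∣p∣ x∈p rewrite x∈p⇒∣p∣≡1+∣p-x∣ x∈p = s≤s z≤n

∣p∣≡1⇒y≡x : ∀ {p : Subset n} {x y} → ∣ p ∣ ≡ 1 → x ∈ p → y ∈ p → y ≡ x
∣p∣≡1⇒y≡x {p = p} {x} {y} ∣p∣≡1 x∈p y∈p with y ≟ x
... | yes y≡x = y≡x
... | no  y≢x = contradiction (subst (1 ≤_) ∣p-x∣≡0 (x∈p⇒1≤∣p∣ (x∈p∧x≢y⇒x∈p-y y∈p y≢x))) λ ()
  where
  ∣p-x∣≡0 : ∣ p - x ∣ ≡ 0
  ∣p-x∣≡0 = sym (suc-injective (trans (sym ∣p∣≡1) (x∈p⇒∣p∣≡1+∣p-x∣ x∈p)))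

x∉p-x : ∀ (p : Subset n) x → x ∉ p - x
x∉p-x (_ ∷ p) zero    ()
x∉p-x (_ ∷ p) (suc x) (there x∈p-x) = x∉p-x p x x∈p-x

x∉∁⁅x⁆ : ∀ (x : Fin n) → x ∉ ∁ ⁅ x ⁆
x∉∁⁅x⁆ x = x∈p⇒x∉∁p (x∈⁅x⁆ x)

x∉∁⁅x⁆-y : ∀ (x y : Fin n) → x ∉ ∁ ⁅ x ⁆ - y
x∉∁⁅x⁆-y x y x∈ = x∉∁⁅x⁆ x (p─q⊆p (∁ ⁅ x ⁆) ⁅ y ⁆ x∈)

x∉p⇒p⊆∁⁅x⁆ : ∀ {p : Subset n} {x} → x ∉ p → p ⊆ ∁ ⁅ x ⁆
x∉p⇒p⊆∁⁅x⁆ {p = p} x∉p y∈p = x∉p⇒x∈∁p (x≢y⇒x∉⁅y⁆ λ y≡x → x∉p (subst (_∈ p) y≡x y∈p))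

∣∁⁅x⁆∣≡n∸1 : ∀ {n} (x : Fin n) → ∣ ∁ ⁅ x ⁆ ∣ ≡ n ∸ 1
∣∁⁅x⁆∣≡n∸1 {n} x = trans (∣∁p∣≡n∸∣p∣ ⁅ x ⁆) (cong (n ∸_) (∣⁅x⁆∣≡1 x))

∣∁⁅x⁆-y∣≡n∸2 : ∀ {n} {x y : Fin n} → y ≢ x → ∣ ∁ ⁅ x ⁆ - y ∣ ≡ n ∸ 2
∣∁⁅x⁆-y∣≡n∸2 {n} {x} {y} y≢x = begin
  ∣ ∁ ⁅ x ⁆ - y ∣  ≡⟨ cong pred (x∈p⇒∣p∣≡1+∣p-x∣ (x∉p⇒x∈∁p (x≢y⇒x∉⁅y⁆ y≢x))) ⟨
  pred ∣ ∁ ⁅ x ⁆ ∣ ≡⟨ cong pred (∣∁⁅x⁆∣≡n∸1 x) ⟩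
  pred (n ∸ 1)     ≡⟨ pred[m∸n]≡m∸[1+n] n 1 ⟩
  n ∸ 2            ∎
  where open ≡-Reasoning

x∉p⇒∣p∣≤n∸1 : ∀ {p : Subset n} {x} → x ∉ p → ∣ p ∣ ≤ n ∸ 1
x∉p⇒∣p∣≤n∸1 {p = p} {x} x∉p = subst (∣ p ∣ ≤_) (∣∁⁅x⁆∣≡n∸1 x) (p⊆q⇒∣p∣≤∣q∣ (x∉p⇒p⊆∁⁅x⁆ x∉p))

x∉p∧y∉p⇒∣p∣≤n∸2 : ∀ {p : Subset n} {x y} → x ≢ y → x ∉ p → y ∉ p → ∣ p ∣ ≤ n ∸ 2
x∉p∧y∉p⇒∣p∣≤n∸2 {p = p} {x} {y} x≢y x∉p y∉p =
  subst (∣ p ∣ ≤_) (∣∁⁅x⁆-y∣≡n∸2 (λ y≡x → x≢y (sym y≡x))) (p⊆q⇒∣p∣≤∣q∣ p⊆∁⁅x⁆-y)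
  where
  p⊆∁⁅x⁆-y : p ⊆ ∁ ⁅ x ⁆ - y
  p⊆∁⁅x⁆-y z∈p = x∈p∧x≢y⇒x∈p-y (x∉p⇒p⊆∁⁅x⁆ x∉p z∈p) λ z≡y → y∉p (subst (_∈ p) z≡y z∈p)

module _ {n : ℕ} (F : Graph n) where

  Universal : Fin n → Set
  Universal u = ∀ v → u ≢ v → Adj F u v

  Nonadjacent : Fin n → Fin n → Set
  Nonadjacent x y = x ≢ y × ¬ Adj F x y

  adj? : ∀ x y → Dec (Adj F x y)
  adj? x y = adj F x y Bool.≟ true

  Adj-sym : ∀ {x y} → Adj F x y → Adj F y x
  Adj-sym {x} {y} x~y = trans (Graph.sym F y x) x~y

  Adj⇒≢ : ∀ {x y} → Adj F x y → x ≢ y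
  Adj⇒≢ {x} x~x refl with trans (sym (irref F x)) x~x
  ... | ()

  universal? : ∀ u → Dec (Universal u)
  universal? u = all? λ v → ¬? (u ≟ v) →-dec adj? u v

  ¬universal⇒nonadjacent : ∀ {u} → ¬ Universal u → ∃ (Nonadjacent u)
  ¬universal⇒nonadjacent {u} ¬univ with ¬∀⟶∃¬ n _ (λ v → ¬? (u ≟ v) →-dec adj? u v) ¬univ
  ... | v , ¬[u≢v→u~v] = v , (λ u≡v → ¬[u≢v→u~v] λ u≢v → ⊥-elim (u≢v u≡v))
                           , (λ u~v → ¬[u≢v→u~v] λ _ → u~v)

  ¬complete⇒nonadjacent : ¬ Complete F → ∃ λ x → ∃ (Nonadjacent x)
  ¬complete⇒nonadjacent ¬complete with ¬∀⟶∃¬ n Universal universal? ¬complete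
  ... | x , ¬univ = x , ¬universal⇒nonadjacent ¬univ

  dominating-nonempty : Fin n → ∀ {D} → Dominating F D → ∃ (_∈ D)
  dominating-nonempty v dom with dom v
  ... | inj₁ v∈D           = v , v∈D
  ... | inj₂ (u , u∈D , _) = u , u∈D

  universal⇒γ≡1 : ∀ {u} → Universal u → IsDominationNumber F 1
  universal⇒γ≡1 {u} univ = (⁅ u ⁆ , dom , ∣⁅x⁆∣≡1 u) , λ _ → x∈p⇒1≤∣p∣ ∘ proj₂ ∘ dominating-nonempty u
    where
    dom : Dominating F ⁅ u ⁆
    dom v with u ≟ v
    ... | yes refl = inj₁ (x∈⁅x⁆ u)
    ... | no  u≢v  = inj₂ (u , x∈⁅x⁆ u , univ v u≢v)

  γ≡1⇒universal : Fin n → IsDominationNumber F 1 → ∃ Universal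
  γ≡1⇒universal v ((D , dom , ∣D∣≡1) , _) with dominating-nonempty v dom
  ... | u , u∈D = u , univ
    where
    univ : Universal u
    univ w u≢w with dom w
    ... | inj₁ w∈D             = ⊥-elim (u≢w (sym (∣p∣≡1⇒y≡x ∣D∣≡1 u∈D w∈D)))
    ... | inj₂ (t , t∈D , t~w) = subst (λ t → Adj F t w) (∣p∣≡1⇒y≡x ∣D∣≡1 u∈D t∈D) t~w

  walk-length0 : ∀ {x y f} → IsWalk F x y 0 f → x ≡ y
  walk-length0 (f0≡x , f0≡y , _) = trans (sym f0≡x) f0≡y

  walk-length1 : ∀ {x y f} → IsWalk F x y 1 f → Adj F x y
  walk-length1 (f0≡x , f1≡y , step) = subst₂ (Adj F) f0≡x f1≡y (step 0 (s≤s z≤n))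

  nonadjacent⇒2≤length : ∀ {x y ℓ f} → Nonadjacent x y → IsWalk F x y ℓ f → 2 ≤ ℓ
  nonadjacent⇒2≤length {ℓ = 0}           (x≢y , _) walk = ⊥-elim (x≢y (walk-length0 walk))
  nonadjacent⇒2≤length {ℓ = 1}           (_ , x≁y) walk = ⊥-elim (x≁y (walk-length1 walk))
  nonadjacent⇒2≤length {ℓ = suc (suc _)} _         _    = s≤s (s≤s z≤n)

  visible-refl : ∀ X x → Visible F X x x
  visible-refl X x = 0 , (λ _ → x) , ((refl , refl , λ _ ()) , λ _ _ _ → z≤n) , λ _ _ ()

  visible-adjacent : ∀ X {x y} → Adj F x y → Visible F X x y
  visible-adjacent X {x} {y} x~y = 1 , path , ((refl , refl , step) , shortest) , λ { 1 _ (s≤s ()) }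
    where
    path : ℕ → Fin n
    path 0 = x
    path (suc _) = y
    step : ∀ i → i < 1 → Adj F (path i) (path (suc i))
    step 0       _        = x~y
    step (suc _) (s≤s ())
    shortest : ∀ ℓ g → IsWalk F x y ℓ g → 1 ≤ ℓ
    shortest 0       _ walk = ⊥-elim (Adj⇒≢ x~y (walk-length0 walk))
    shortest (suc _) _ _    = s≤s z≤n

  visible-commonNeighbour : ∀ X {x y z} → Nonadjacent x y → Adj F x z → Adj F z y → z ∉ X → Visible F X x y
  visible-commonNeighbour X {x} {y} {z} xy x~z z~y z∉X =
    2 , path , ((refl , refl , step) , λ _ _ → nonadjacent⇒2≤length xy) , interior
    where
    path : ℕ → Fin n
    path 0 = x
    path 1 = z
    path (suc (suc _)) = y
    step : ∀ i → i < 2 → Adj F (path i) (path (suc i))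
    step 0 _ = x~z
    step 1 _ = z~y
    step (suc (suc _)) (s≤s (s≤s ()))
    interior : ∀ i → 0 < i → i < 2 → path i ∉ X
    interior 1             _ _                 = z∉X
    interior (suc (suc _)) _ (s≤s (s≤s ()))

  commonNeighbours⇒totalMutualVisibility : ∀ X →
    (∀ {x y} → Nonadjacent x y → ∃ λ z → Adj F x z × Adj F z y × z ∉ X) →
    IsTotalMutualVisibility F X
  commonNeighbours⇒totalMutualVisibility X common x y with x ≟ y | adj? x y
  ... | yes refl | _       = visible-refl X x
  ... | no _     | yes x~y = visible-adjacent X x~y
  ... | no x≢y   | no x≁y  with common (x≢y , x≁y)
  ... | z , x~z , z~y , z∉X = visible-commonNeighbour X (x≢y , x≁y) x~z z~y z∉X

  totalMutualVisibility⇒freeNeighbour : ∀ {X} → IsTotalMutualVisibility F X →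
    ∀ {x y} → Nonadjacent x y → ∃ λ z → z ∉ X × Adj F x z
  totalMutualVisibility⇒freeNeighbour tmv {x} {y} xy with tmv x y
  ... | ℓ , f , (walk@(f0≡x , _ , step) , _) , interior with nonadjacent⇒2≤length xy walk
  ... | s≤s 1≤ℓ-1 = f 1 , interior 1 (s≤s z≤n) (s≤s 1≤ℓ-1)
                        , subst (λ t → Adj F t (f 1)) f0≡x (step 0 (s≤s z≤n))

  totalMutualVisibility⇒∣X∣≤n∸1 : ¬ Complete F → ∀ {X} → IsTotalMutualVisibility F X → ∣ X ∣ ≤ n ∸ 1
  totalMutualVisibility⇒∣X∣≤n∸1 ¬complete tmv with ¬complete⇒nonadjacent ¬complete
  ... | _ , _ , xy with totalMutualVisibility⇒freeNeighbour tmv xy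
  ... | _ , z∉X , _ = x∉p⇒∣p∣≤n∸1 z∉X

  totalMutualVisibility⇒∣X∣≤n∸2 : ¬ Complete F → (∀ w → ¬ Universal w) →
    ∀ {X} → IsTotalMutualVisibility F X → ∣ X ∣ ≤ n ∸ 2
  totalMutualVisibility⇒∣X∣≤n∸2 ¬complete ¬univ tmv with ¬complete⇒nonadjacent ¬complete
  ... | _ , _ , xy with totalMutualVisibility⇒freeNeighbour tmv xy
  ... | z , z∉X , _ with totalMutualVisibility⇒freeNeighbour tmv (proj₂ (¬universal⇒nonadjacent (¬univ z)))
  ... | v , v∉X , z~v = x∉p∧y∉p⇒∣p∣≤n∸2 (Adj⇒≢ z~v) z∉X v∉X

  universal⇒totalMutualVisibility : ∀ {u} → Universal u → IsTotalMutualVisibility F (∁ ⁅ u ⁆)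
  universal⇒totalMutualVisibility {u} univ = commonNeighbours⇒totalMutualVisibility _ common
    where
    common : ∀ {x y} → Nonadjacent x y → ∃ λ z → Adj F x z × Adj F z y × z ∉ ∁ ⁅ u ⁆
    common {x} {y} (x≢y , x≁y) = u , Adj-sym (univ x u≢x) , univ y u≢y , x∉∁⁅x⁆ u
      where
      u≢x : u ≢ x
      u≢x refl = x≁y (univ y x≢y)
      u≢y : u ≢ y
      u≢y refl = x≁y (Adj-sym (univ x λ y≡x → x≢y (sym y≡x)))

data Side (a b : ℕ) : Fin (a + b) → Set where
  left  : (x : Fin a) → Side a b (x ↑ˡ b)
  right : (y : Fin b) → Side a b (a ↑ʳ y)

side : ∀ a {b} (u : Fin (a + b)) → Side a b u
side a {b} u with splitAt a u in eq
... | inj₁ x = subst (Side a b) (splitAt⁻¹-↑ˡ eq) (left x)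
... | inj₂ y = subst (Side a b) (splitAt⁻¹-↑ʳ eq) (right y)

↑ˡ≢↑ʳ : ∀ {a b} (x : Fin a) (y : Fin b) → x ↑ˡ b ≢ a ↑ʳ y
↑ˡ≢↑ʳ {a} {b} x y eq with trans (sym (splitAt-↑ˡ a x b)) (trans (cong (splitAt a) eq) (splitAt-↑ʳ a b y))
... | ()

module _ {a b : ℕ} (G : Graph a) (H : Graph b) where

  adj-⊕ˡ : ∀ x y → adj (G ⊕ H) (x ↑ˡ b) (y ↑ˡ b) ≡ adj G x y
  adj-⊕ˡ x y rewrite splitAt-↑ˡ a x b | splitAt-↑ˡ a y b = refl

  adj-⊕ʳ : ∀ x y → adj (G ⊕ H) (a ↑ʳ x) (a ↑ʳ y) ≡ adj H x y
  adj-⊕ʳ x y rewrite splitAt-↑ʳ a b x | splitAt-↑ʳ a b y = refl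

  Adj-⊕ˡʳ : ∀ x y → Adj (G ⊕ H) (x ↑ˡ b) (a ↑ʳ y)
  Adj-⊕ˡʳ x y rewrite splitAt-↑ˡ a x b | splitAt-↑ʳ a b y = refl

  Adj-⊕ʳˡ : ∀ x y → Adj (G ⊕ H) (a ↑ʳ x) (y ↑ˡ b)
  Adj-⊕ʳˡ x y rewrite splitAt-↑ʳ a b x | splitAt-↑ˡ a y b = refl

  ⊕-¬complete : ¬ (Complete G × Complete H) → ¬ Complete (G ⊕ H)
  ⊕-¬complete ¬both complete = ¬both (completeˡ , completeʳ)
    where
    completeˡ : Complete G
    completeˡ x y x≢y = trans (sym (adj-⊕ˡ x y)) (complete _ _ (x≢y ∘ ↑ˡ-injective b x y))
    completeʳ : Complete H
    completeʳ x y x≢y = trans (sym (adj-⊕ʳ x y)) (complete _ _ (x≢y ∘ ↑ʳ-injective a x y))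

  ⊕-universalˡ : ∀ {u} → Universal G u → Universal (G ⊕ H) (u ↑ˡ b)
  ⊕-universalˡ {u} univ v u≢v with side a v
  ... | left y  = trans (adj-⊕ˡ u y) (univ y (u≢v ∘ cong (_↑ˡ b)))
  ... | right y = Adj-⊕ˡʳ u y

  ⊕-¬universal : (∀ x → ¬ Universal G x) → (∀ y → ¬ Universal H y) → ∀ w → ¬ Universal (G ⊕ H) w
  ⊕-¬universal ¬univG ¬univH w univ with side a w
  ... | left x  = ¬univG x λ y x≢y → trans (sym (adj-⊕ˡ x y)) (univ (y ↑ˡ b) (x≢y ∘ ↑ˡ-injective b x y))
  ... | right x = ¬univH x λ y x≢y → trans (sym (adj-⊕ʳ x y)) (univ (a ↑ʳ y) (x≢y ∘ ↑ʳ-injective a x y))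

  ⊕-totalMutualVisibility : ∀ {X x y} → x ↑ˡ b ∉ X → a ↑ʳ y ∉ X → IsTotalMutualVisibility (G ⊕ H) X
  ⊕-totalMutualVisibility {X} {x} {y} x∉X y∉X = commonNeighbours⇒totalMutualVisibility (G ⊕ H) X common
    where
    common : ∀ {p q} → Nonadjacent (G ⊕ H) p q → ∃ λ z → Adj (G ⊕ H) p z × Adj (G ⊕ H) z q × z ∉ X
    common {p} {q} (_ , p≁q) with side a p | side a q
    ... | left p′  | left q′  = a ↑ʳ y , Adj-⊕ˡʳ p′ y , Adj-⊕ʳˡ y q′ , y∉X
    ... | right p′ | right q′ = x ↑ˡ b , Adj-⊕ʳˡ p′ x , Adj-⊕ˡʳ x q′ , x∉X
    ... | left p′  | right q′ = ⊥-elim (p≁q (Adj-⊕ˡʳ p′ q′))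
    ... | right p′ | left q′  = ⊥-elim (p≁q (Adj-⊕ʳˡ p′ q′))

corollary2p8 : (m k : ℕ) (G : Graph (suc m)) (H : Graph (suc k)) →
    ¬ (Complete G × Complete H) →
    (IsDominationNumber G 1 → IsMuT (G ⊕ H) (suc m + suc k ∸ 1))
    × (¬ IsDominationNumber G 1 → ¬ IsDominationNumber H 1 →
    IsMuT (G ⊕ H) (suc m + suc k ∸ 2))
corollary2p8 m k G H ¬complete = universalInG , noUniversal
  where
  ¬complete-⊕ : ¬ Complete (G ⊕ H)
  ¬complete-⊕ = ⊕-¬complete G H ¬complete

  universalInG : IsDominationNumber G 1 → IsMuT (G ⊕ H) (suc m + suc k ∸ 1)
  universalInG γG≡1 with γ≡1⇒universal G zero γG≡1
  ... | u , univ =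
    (∁ ⁅ u ↑ˡ suc k ⁆ , universal⇒totalMutualVisibility (G ⊕ H) (⊕-universalˡ G H univ) , ∣∁⁅x⁆∣≡n∸1 (u ↑ˡ suc k)) ,
    λ _ → totalMutualVisibility⇒∣X∣≤n∸1 (G ⊕ H) ¬complete-⊕

  noUniversal : ¬ IsDominationNumber G 1 → ¬ IsDominationNumber H 1 → IsMuT (G ⊕ H) (suc m + suc k ∸ 2)
  noUniversal γG≢1 γH≢1 =
    (∁ ⁅ x ⁆ - y , ⊕-totalMutualVisibility G H (x∉∁⁅x⁆-y x y) (x∉p-x (∁ ⁅ x ⁆) y) , ∣∁⁅x⁆-y∣≡n∸2 y≢x) ,
    λ _ → totalMutualVisibility⇒∣X∣≤n∸2 (G ⊕ H) ¬complete-⊕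
            (⊕-¬universal G H (λ _ → γG≢1 ∘ universal⇒γ≡1 G) (λ _ → γH≢1 ∘ universal⇒γ≡1 H))
    where
    x = zero ↑ˡ suc k
    y = suc m ↑ʳ zero
    y≢x : y ≢ x
    y≢x = ↑ˡ≢↑ʳ zero zero ∘ sym
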